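{- Let $\sigma$ be a split type and let $n\ge 1$. The number of permutations $\pi\in S_n$ whose split type is $\sigma$ equals $$M(n,\sigma)=\left[\begin{matrix} n+q(\sigma)-m(\sigma)\\ q(\sigma)\end{matrix}\right],$$ where for integers $i,j$ we set $\left[\begin{smallmatrix} i\\ j\end{smallmatrix}\right]=\binom{i}{j}$ if $0\le j\le i$ and $\left[\begin{smallmatrix} i\\ j\end{smallmatrix}\right]=0$ otherwise.
   Context: For $n\ge1$, $S_n$ is the group of permutations of $[n]=\{1,\dots,n\}$, written in one-line notation $\pi=(\pi(1)\pi(2)\ldots\pi(n))$. $S_\infty$ is the group of permutations of $\{1,2,3,\dots\}$ fixing all but finitely many entries; $S_n$ is identified with the subgroup of $S_\infty$ of permutations fixing every entry $>n$, so $S_n\subset S_{n'}\subset S_\infty$ for $n<n'$. For $\pi\in S_a$, $\tau\in S_b$ the concatenation is $\pi+\tau=(\pi(1)\ldots\pi(a)\,(a+\tau(1))\ldots(a+\tau(b)))\in S_{a+b}$; concatenation is associative. A permutation in $S_n$ is connected if it cannot be written as $\pi+\tau$ with $\pi\in S_a$, $\tau\in S_b$, $a,b\ge1$. Every permutation in $S_n$ has a unique decomposition as a concatenation of connected permutations (its split decomposition). The split type of $\pi\in S_n$ is the concatenation, in order, of those parts of its split decomposition that are not the trivial permutation $(1)\in S_1$. A split type is a permutation $\sigma\in S_m$ (for some $m$) all of whose split-decomposition parts are nontrivial (lie in some $S_j$ with $j\ge2$); $S_m'$ is the set of split types in $S_m$. For a split type $\sigma$, $m(\sigma)$ is the unique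 $m$ with $\sigma\in S_m'$, and $q(\sigma)$ is the number of parts of the split decomposition of $\sigma$ (as an element of $S_{m(\sigma)}$). -}

module Defs where

open import Data.Nat using (ℕ; suc; _+_; _≤_)
open import Data.Nat.Combinatorics using (_C_)
open import Data.Integer as ℤ using (ℤ; +_; ∣_∣)
open import Data.List using (List; []; _∷_; _++_; map; length; upTo; filter; foldr)
open import Data.List.Properties using (≡-dec)
open import Data.List.Relation.Binary.Permutation.Propositional using (_↭_)
open import Data.List.Relation.Unary.All using (All)
open import Data.Product using (Σ; ∃; _×_; ∃-syntax)
open import Data.Nat.Properties using () renaming (_≟_ to _≟ℕ_)
open import Relation.Nullary using (¬_; ¬?; Dec; yes; no)
open import Relation.Binary.PropositionalEquality using (_≡_; _≢_)

-- A permutation is given in one-line notation as a list of naturals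
-- (values 1..n).  π ∈ S n  iff  π is a rearrangement of [1,2,...,n].
OneLine : Set
OneLine = List ℕ

oneTo : ℕ → List ℕ
oneTo n = map suc (upTo n)

InS : ℕ → OneLine → Set
InS n π = π ↭ oneTo n

_⊕_ : OneLine → OneLine → OneLine
π ⊕ τ = π ++ map (λ x → length π + x) τ

infixr 5 _⊕_

Decomposable : ℕ → OneLine → Set
Decomposable n π =
  ∃[ a ] ∃[ b ] ∃[ π₁ ] ∃[ τ ]
    (1 ≤ a × 1 ≤ b × a + b ≡ n × InS a π₁ × InS b τ × π ≡ π₁ ⊕ τ)

Connected : ℕ → OneLine → Set
Connected n π = 1 ≤ n × InS n π × ¬ Decomposable n π

concatP : List OneLine → OneLine
concatP = foldr _⊕_ []

SplitDecomp : OneLine → List OneLine → Set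
SplitDecomp π ps = All (λ p → ∃[ j ] Connected j p) ps × π ≡ concatP ps

trivial : OneLine
trivial = 1 ∷ []

Nontrivial : OneLine → Set
Nontrivial p = p ≢ trivial

nontrivial? : (p : OneLine) → Dec (Nontrivial p)
nontrivial? p = ¬? (≡-dec _≟ℕ_ p trivial)

IsSplitTypeOf : OneLine → OneLine → Set
IsSplitTypeOf π σ = ∃[ ps ] (SplitDecomp π ps × σ ≡ concatP (filter nontrivial? ps))

IsSplitType : ℕ → OneLine → Set
IsSplitType m σ = InS m σ × (∀ ps → SplitDecomp σ ps → All Nontrivial ps)

bracket : ℤ → ℤ → ℕ
bracket i j with (+ 0) ℤ.≤? j | j ℤ.≤? i
... | yes _ | yes _ = ∣ i ∣ C ∣ j ∣
... | _     | _     = 0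

-- M(n,σ) with m = m(σ), q = q(σ)
M : ℕ → ℕ → ℕ → ℕ
M n m q = bracket (+ (n + q) ℤ.- + m) (+ q)

module Submission where

-- Let σ be a split type with split decomposition ps = [p₁, …, p_q] and
-- σ ∈ S_m.  A permutation π has split type σ exactly when its split
-- decomposition arises from the word ps by inserting some number k of trivial
-- parts (1) at arbitrary positions; such a π lies in S_(k+m).  So for n ≥ m the
-- permutations of split type σ in S_n are the concatenations of the
-- C(n−m+q, q) ways of inserting n − m trivial parts into ps, and for n < m
-- there are none; in both cases their number is M(n, σ).

open import Defs
open import Data.Nat using (ℕ; zero; suc; _+_; _∸_; _≤_; _<_; z≤n; s≤s; _≤?_)
open import Data.Nat.Properties
open import Algebra.Properties.CommutativeSemigroup +-commutativeSemigroup using (x∙yz≈y∙xz)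
open import Data.Nat.Combinatorics using (_C_; nCk+nC[k+1]≡[n+1]C[k+1]; nCn≡1)
open import Data.Integer as ℤ using (_⊖_)
import Data.Integer.Properties as ℤP
open import Data.List using (List; []; _∷_; _++_; map; length; filter; upTo; applyUpTo)
open import Data.List.Properties
  using (length-map; length-++; length-upTo; map-++; map-∘; map-cong; map-id-local; map-upTo; map-injective;
         ++-cancelˡ; ++-conicalˡ; ++-identityʳ; ∷-injective; ∷-injectiveˡ; ∷-injectiveʳ;
         filter-accept; filter-reject; filter-all; filter-none; ≡-dec)
open import Data.List.Membership.Propositional using (_∈_)
open import Data.List.Membership.Propositional.Properties using (∈-++⁻; ∈-++⁺ˡ; ∈-++⁺ʳ; ∈-map⁻; ∈-map⁺)
open import Data.List.Relation.Unary.Any using (here)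
open import Data.List.Relation.Unary.All as All using (All; []; _∷_)
import Data.List.Relation.Unary.All.Properties as AllP
open import Data.List.Relation.Unary.Unique.Propositional using (Unique)
import Data.List.Relation.Unary.Unique.Propositional.Properties as UniqueP
open import Data.List.Relation.Unary.AllPairs using ([]; _∷_)
open import Data.List.Relation.Binary.Disjoint.Propositional using (Disjoint)
open import Data.List.Relation.Binary.Permutation.Propositional using (_↭_; ↭-sym; ↭-trans; ↭-refl)
open import Data.List.Relation.Binary.Permutation.Propositional.Properties
  using (↭-length; ++⁺; ++⁺ʳ; map⁺; drop-∷; All-resp-↭)
open import Data.Product using (∃-syntax; _×_; _,_; proj₁)
open import Data.Sum using (inj₁; inj₂)
open import Data.Empty using (⊥-elim)
open import Function using (_∘_)
open import Function.Bundles using (_⇔_; mk⇔)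
open import Relation.Nullary using (¬_; ¬?; yes; no)
open import Relation.Unary using (Decidable)
open import Relation.Binary.Definitions using (DecidableEquality)
open import Relation.Binary.PropositionalEquality

-- (1) Inserting k copies of a letter x into a word.

module Insertions {A : Set} (_≟_ : DecidableEquality A) (x : A) where

  ≢x? : Decidable (_≢ x)
  ≢x? y = ¬? (y ≟ x)

  ≡x? : Decidable (_≡ x)
  ≡x? y = y ≟ x

  copies : List A → ℕ
  copies r = length (filter ≡x? r)

  Insertion : ℕ → List A → List A → Set
  Insertion k ws r = filter ≢x? r ≡ ws × copies r ≡ k

  insertions : ℕ → List A → List (List A)
  insertions zero    ws       = ws ∷ []
  insertions (suc k) []       = map (x ∷_) (insertions k [])
  insertions (suc k) (w ∷ ws) =
    map (x ∷_) (insertions k (w ∷ ws)) ++ map (w ∷_) (insertions (suc k) ws)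

  filter-x∷ : ∀ r → filter ≢x? (x ∷ r) ≡ filter ≢x? r
  filter-x∷ r = filter-reject ≢x? (λ x≢x → x≢x refl)

  filter-w∷ : ∀ {w} r → w ≢ x → filter ≢x? (w ∷ r) ≡ w ∷ filter ≢x? r
  filter-w∷ r w≢x = filter-accept ≢x? w≢x

  copies-x∷ : ∀ r → copies (x ∷ r) ≡ suc (copies r)
  copies-x∷ r = cong length (filter-accept ≡x? refl)

  copies-w∷ : ∀ {w} r → w ≢ x → copies (w ∷ r) ≡ copies r
  copies-w∷ r w≢x = cong length (filter-reject ≡x? w≢x)

  insertion-x∷ : ∀ {k ws r} → Insertion k ws r → Insertion (suc k) ws (x ∷ r)
  insertion-x∷ {r = r} (f , c) = trans (filter-x∷ r) f , trans (copies-x∷ r) (cong suc c)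

  insertion-w∷ : ∀ {k w ws r} → w ≢ x → Insertion k ws r → Insertion k (w ∷ ws) (w ∷ r)
  insertion-w∷ {r = r} w≢x (f , c) = trans (filter-w∷ r w≢x) (cong (_ ∷_) f) , trans (copies-w∷ r w≢x) c

  insertions-sound : ∀ k {ws r} → All (_≢ x) ws → r ∈ insertions k ws → Insertion k ws r
  insertions-sound zero ws≢x (here refl) = filter-all ≢x? ws≢x , cong length (filter-none ≡x? ws≢x)
  insertions-sound (suc k) [] r∈ with ∈-map⁻ (x ∷_) r∈
  ... | _ , r′∈ , refl = insertion-x∷ (insertions-sound k [] r′∈)
  insertions-sound (suc k) {w ∷ ws} (w≢x ∷ ws≢x) r∈ with ∈-++⁻ (map (x ∷_) (insertions k (w ∷ ws))) r∈
  ... | inj₁ r∈ˡ with ∈-map⁻ (x ∷_) r∈ˡ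
  ...   | _ , r′∈ , refl = insertion-x∷ (insertions-sound k (w≢x ∷ ws≢x) r′∈)
  insertions-sound (suc k) {w ∷ ws} (w≢x ∷ ws≢x) r∈ | inj₂ r∈ʳ with ∈-map⁻ (w ∷_) r∈ʳ
  ...   | _ , r′∈ , refl = insertion-w∷ w≢x (insertions-sound (suc k) ws≢x r′∈)

  x∷-∈ : ∀ k ws {r} → r ∈ insertions k ws → x ∷ r ∈ insertions (suc k) ws
  x∷-∈ k []       r∈ = ∈-map⁺ (x ∷_) r∈
  x∷-∈ k (w ∷ ws) r∈ = ∈-++⁺ˡ (∈-map⁺ (x ∷_) r∈)

  w∷-∈ : ∀ k {w ws r} → r ∈ insertions k ws → w ∷ r ∈ insertions k (w ∷ ws)
  w∷-∈ zero    (here refl) = here refl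
  w∷-∈ (suc k) r∈          = ∈-++⁺ʳ _ (∈-map⁺ (_ ∷_) r∈)

  insertions-complete : ∀ r → r ∈ insertions (copies r) (filter ≢x? r)
  insertions-complete []      = here refl
  insertions-complete (y ∷ r) with y ≟ x
  ... | yes refl = x∷-∈ (copies r) (filter ≢x? r) (insertions-complete r)
  ... | no _     = w∷-∈ (copies r) {y} {filter ≢x? r} (insertions-complete r)

  insertion⇒∈ : ∀ {k ws r} → Insertion k ws r → r ∈ insertions k ws
  insertion⇒∈ {r = r} (refl , refl) = insertions-complete r

  insertions-unique : ∀ k {ws} → All (_≢ x) ws → Unique (insertions k ws)
  insertions-unique zero    _  = [] ∷ []
  insertions-unique (suc k) [] = UniqueP.map⁺ ∷-injectiveʳ (insertions-unique k [])
  insertions-unique (suc k) {w ∷ ws} (w≢x ∷ ws≢x) =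
    UniqueP.++⁺ (UniqueP.map⁺ ∷-injectiveʳ (insertions-unique k (w≢x ∷ ws≢x)))
                (UniqueP.map⁺ ∷-injectiveʳ (insertions-unique (suc k) ws≢x))
                first-letters-differ
    where
    first-letters-differ : Disjoint (map (x ∷_) (insertions k (w ∷ ws))) (map (w ∷_) (insertions (suc k) ws))
    first-letters-differ (r∈ˡ , r∈ʳ) with ∈-map⁻ (x ∷_) r∈ˡ | ∈-map⁻ (w ∷_) r∈ʳ
    ... | _ , _ , refl | _ , _ , e = w≢x (sym (∷-injectiveˡ e))

  -- Pascal's rule, following the two cases of the definition
  length-insertions : ∀ k ws → length (insertions k ws) ≡ (k + length ws) C length ws
  length-insertions zero    ws = sym (nCn≡1 (length ws))
  length-insertions (suc k) [] = trans (length-map (x ∷_) (insertions k [])) (length-insertions k [])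
  length-insertions (suc k) (w ∷ ws) = begin
    length (map (x ∷_) L₁ ++ map (w ∷_) L₂)            ≡⟨ length-++ (map (x ∷_) L₁) ⟩
    length (map (x ∷_) L₁) + length (map (w ∷_) L₂)   ≡⟨ cong₂ _+_ (length-map _ L₁) (length-map _ L₂) ⟩
    length L₁ + length L₂                             ≡⟨ cong₂ _+_ (length-insertions k (w ∷ ws)) (length-insertions (suc k) ws) ⟩
    (k + suc q) C suc q + (suc k + q) C q             ≡⟨ cong (λ n → n C suc q + (suc k + q) C q) (+-suc k q) ⟩
    (suc k + q) C suc q + (suc k + q) C q             ≡⟨ +-comm ((suc k + q) C suc q) _ ⟩
    (suc k + q) C q + (suc k + q) C suc q             ≡⟨ nCk+nC[k+1]≡[n+1]C[k+1] (suc k + q) q ⟩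
    suc (suc k + q) C suc q                           ≡⟨ cong (_C suc q) (sym (+-suc (suc k) q)) ⟩
    (suc k + suc q) C suc q                           ∎
    where
    open ≡-Reasoning
    L₁ = insertions k (w ∷ ws)
    L₂ = insertions (suc k) ws
    q  = length ws

  All-insert : ∀ {P : A → Set} → P x → ∀ r → All P (filter ≢x? r) → All P r
  All-insert Px []      [] = []
  All-insert Px (y ∷ r) Ps with y ≟ x | Ps
  ... | yes refl | Pr     = Px ∷ All-insert Px r Pr
  ... | no _     | Py ∷ Pr = Py ∷ All-insert Px r Pr

ConnectedPart : OneLine → Set
ConnectedPart p = ∃[ j ] Connected j p

length-oneTo : ∀ n → length (oneTo n) ≡ n
length-oneTo n = trans (length-map suc (upTo n)) (length-upTo n)

InS⇒length : ∀ {n π} → InS n π → length π ≡ n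
InS⇒length {n} π∈Sn = trans (↭-length π∈Sn) (length-oneTo n)

length-⊕ : ∀ (p t : OneLine) → length (p ⊕ t) ≡ length p + length t
length-⊕ p t = trans (length-++ p) (cong (length p +_) (length-map _ t))

applyUpTo-+ : ∀ {A : Set} (f : ℕ → A) a b → applyUpTo f (a + b) ≡ applyUpTo f a ++ applyUpTo (f ∘ (a +_)) b
applyUpTo-+ f zero    b = refl
applyUpTo-+ f (suc a) b = cong (f 0 ∷_) (applyUpTo-+ (f ∘ suc) a b)

oneTo-+ : ∀ a b → oneTo (a + b) ≡ oneTo a ++ map (a +_) (oneTo b)
oneTo-+ a b = begin
  map suc (upTo (a + b))                            ≡⟨ cong (map suc) (applyUpTo-+ (λ i → i) a b) ⟩
  map suc (upTo a ++ applyUpTo (a +_) b)            ≡⟨ map-++ suc (upTo a) _ ⟩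
  oneTo a ++ map suc (applyUpTo (a +_) b)           ≡⟨ cong (oneTo a ++_) shifted ⟩
  oneTo a ++ map (a +_) (oneTo b)                   ∎
  where
  open ≡-Reasoning
  shifted : map suc (applyUpTo (a +_) b) ≡ map (a +_) (map suc (upTo b))
  shifted = begin
    map suc (applyUpTo (a +_) b)        ≡⟨ cong (map suc) (sym (map-upTo (a +_) b)) ⟩
    map suc (map (a +_) (upTo b))       ≡⟨ sym (map-∘ (upTo b)) ⟩
    map (suc ∘ (a +_)) (upTo b)         ≡⟨ map-cong (λ i → sym (+-suc a i)) (upTo b) ⟩
    map ((a +_) ∘ suc) (upTo b)         ≡⟨ map-∘ (upTo b) ⟩
    map (a +_) (map suc (upTo b))       ∎

InS-⊕ : ∀ {a b p t} → InS a p → InS b t → InS (a + b) (p ⊕ t)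
InS-⊕ {a} {b} {p} {t} p∈Sa t∈Sb =
  subst (p ⊕ t ↭_) (sym (oneTo-+ a b))
    (++⁺ p∈Sa (subst (λ k → map (k +_) t ↭ map (a +_) (oneTo b)) (sym (InS⇒length p∈Sa)) (map⁺ (a +_) t∈Sb)))

InS-concatP : ∀ {ps} → All ConnectedPart ps → InS (length (concatP ps)) (concatP ps)
InS-concatP {[]}     []                          = ↭-refl
InS-concatP {p ∷ ps} ((_ , _ , p∈S , _) ∷ conn) =
  subst (λ n → InS n (p ⊕ concatP ps))
    (sym (trans (length-⊕ p (concatP ps)) (cong (_+ length (concatP ps)) (InS⇒length p∈S))))
    (InS-⊕ p∈S (InS-concatP conn))

-- (3) Uniqueness of the split decomposition.

++-prefix : ∀ {A : Set} (p p′ : List A) {X X′} → p ++ X ≡ p′ ++ X′ → length p ≤ length p′ → ∃[ t ] p′ ≡ p ++ t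
++-prefix []      p′       _ _           = p′ , refl
++-prefix (y ∷ p) (y′ ∷ p′) e (s≤s p≤p′) with ∷-injective e
... | refl , e′ with ++-prefix p p′ e′ p≤p′
...   | t , refl = t , refl

↭-++-cancelˡ : ∀ {A : Set} (p : List A) {ys zs} → p ++ ys ↭ p ++ zs → ys ↭ zs
↭-++-cancelˡ []      h = h
↭-++-cancelˡ (_ ∷ p) h = ↭-++-cancelˡ p (drop-∷ h)

↭-unshift : ∀ a {t u} → t ↭ map (a +_) u → ∃[ τ ] (τ ↭ u × t ≡ map (a +_) τ)
↭-unshift a {t} {u} t↭u+a = map (_∸ a) t , τ↭u , sym t-unshifted
  where
  a≤t : All (a ≤_) t
  a≤t = All-resp-↭ (↭-sym t↭u+a) (AllP.map⁺ (All.universal (m≤m+n a) u))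
  τ↭u : map (_∸ a) t ↭ u
  τ↭u = subst (map (_∸ a) t ↭_)
          (trans (sym (map-∘ u)) (map-id-local (All.universal (m+n∸m≡n a) u)))
          (map⁺ (_∸ a) t↭u+a)
  t-unshifted : map (a +_) (map (_∸ a) t) ≡ t
  t-unshifted = trans (sym (map-∘ t)) (map-id-local (All.map m+[n∸m]≡n a≤t))

-- a proper extension of a permutation in S_a (a ≥ 1) that is again a
-- permutation is decomposable: the extension is a shifted permutation
extension-decomposable : ∀ {a n p t} → 1 ≤ a → InS a p → InS n (p ++ t) → t ≢ [] → Decomposable n (p ++ t)
extension-decomposable {t = []}    _ _ _ t≢[] = ⊥-elim (t≢[] refl)
extension-decomposable {a} {n} {p} {t@(_ ∷ _)} 1≤a p∈Sa pt∈Sn _ =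
  decompose (↭-unshift a (↭-++-cancelˡ p pt↭p+shift))
  where
  b = length t
  n≡a+b : n ≡ a + b
  n≡a+b = trans (sym (InS⇒length pt∈Sn)) (trans (length-++ p) (cong (_+ b) (InS⇒length p∈Sa)))
  pt↭p+shift : p ++ t ↭ p ++ map (a +_) (oneTo b)
  pt↭p+shift = ↭-trans (subst (p ++ t ↭_) (trans (cong oneTo n≡a+b) (oneTo-+ a b)) pt∈Sn)
                       (++⁺ʳ _ (↭-sym p∈Sa))
  decompose : ∃[ τ ] (InS b τ × t ≡ map (a +_) τ) → Decomposable n (p ++ t)
  decompose (τ , τ∈Sb , t≡τ+a) =
    a , b , p , τ , 1≤a , s≤s z≤n , sym n≡a+b , p∈Sa , τ∈Sb ,
    cong (p ++_) (trans t≡τ+a (cong (λ k → map (k +_) τ) (sym (InS⇒length p∈Sa))))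

connected-maximal : ∀ {a n p t} → Connected a p → Connected n (p ++ t) → t ≡ []
connected-maximal {t = []}    _                 _                = refl
connected-maximal {t = _ ∷ _} (1≤a , p∈Sa , _) (_ , pt∈Sn , nd) =
  ⊥-elim (nd (extension-decomposable 1≤a p∈Sa pt∈Sn (λ ())))

connected-prefix : ∀ {a a′ p p′ X X′} → Connected a p → Connected a′ p′ → p ++ X ≡ p′ ++ X′ → p ≡ p′
connected-prefix {p = p} {p′} c c′ e with ≤-total (length p) (length p′)
... | inj₁ p≤p′ with ++-prefix p p′ e p≤p′
...   | t , refl = sym (trans (cong (p ++_) (connected-maximal c c′)) (++-identityʳ p))
connected-prefix {p = p} {p′} c c′ e | inj₂ p′≤p with ++-prefix p′ p (sym e) p′≤p
...   | t , refl = trans (cong (p′ ++_) (connected-maximal c′ c)) (++-identityʳ p′)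

connected-nonempty : ∀ {j p} → Connected j p → p ≢ []
connected-nonempty (1≤j , p∈Sj , _) refl = <⇒≢ 1≤j (InS⇒length p∈Sj)

concatP-injective : ∀ {ps ps′} → All ConnectedPart ps → All ConnectedPart ps′ → concatP ps ≡ concatP ps′ → ps ≡ ps′
concatP-injective []                []                  _ = refl
concatP-injective []                ((_ , c′) ∷ _)      e = ⊥-elim (connected-nonempty c′ (++-conicalˡ _ _ (sym e)))
concatP-injective ((_ , c) ∷ _)     []                  e = ⊥-elim (connected-nonempty c (++-conicalˡ _ _ e))
concatP-injective {p ∷ ps} ((_ , c) ∷ conn) ((_ , c′) ∷ conn′) e with connected-prefix c c′ e
... | refl = cong (p ∷_) (concatP-injective conn conn′
               (map-injective (+-cancelˡ-≡ (length p) _ _) (++-cancelˡ p _ _ e)))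

unique-map-on : ∀ {A B : Set} {P : A → Set} {f : A → B} → (∀ {a b} → P a → P b → f a ≡ f b → a ≡ b) →
                ∀ {xs} → All P xs → Unique xs → Unique (map f xs)
unique-map-on inj []         []           = []
unique-map-on inj (Pa ∷ Pxs) (a∉xs ∷ uxs) =
  AllP.map⁺ (All.zipWith (λ (a≢b , Pb) fa≡fb → a≢b (inj Pa Pb fa≡fb)) (a∉xs , Pxs)) ∷ unique-map-on inj Pxs uxs

-- (4) Trivial parts: the split decompositions with split type σ are the words
-- obtained by inserting copies of the trivial permutation.

open Insertions (≡-dec _≟_) trivial

trivial-connected : ConnectedPart trivial
trivial-connected = 1 , s≤s z≤n , ↭-refl , trivial-indecomposable
  where
  trivial-indecomposable : ¬ Decomposable 1 trivial
  trivial-indecomposable (suc a , suc b , _ , _ , _ , _ , a+b≡1 , _) =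
    1+n≢0 (trans (sym (+-suc a b)) (suc-injective a+b≡1))

length-concatP : ∀ r → length (concatP r) ≡ copies r + length (concatP (filter nontrivial? r))
length-concatP []      = refl
length-concatP (p ∷ r) with ≡-dec _≟_ p trivial
... | yes refl = cong suc (trans (length-map _ (concatP r)) (length-concatP r))
... | no _     = begin
  length (p ⊕ concatP r)                         ≡⟨ length-⊕ p (concatP r) ⟩
  length p + length (concatP r)                  ≡⟨ cong (length p +_) (length-concatP r) ⟩
  length p + (copies r + length (concatP r′))    ≡⟨ x∙yz≈y∙xz (length p) (copies r) _ ⟩
  copies r + (length p + length (concatP r′))    ≡⟨ cong (copies r +_) (sym (length-⊕ p (concatP r′))) ⟩
  copies r + length (p ⊕ concatP r′)             ∎
  where
  open ≡-Reasoning
  r′ = filter nontrivial? r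

bracket-≤ : ∀ {i j} → j ≤ i → bracket (ℤ.+ i) (ℤ.+ j) ≡ i C j
bracket-≤ {i} {j} j≤i with ℤ.+ 0 ℤ.≤? ℤ.+ j | ℤ.+ j ℤ.≤? ℤ.+ i
... | yes _   | yes _    = refl
... | no 0≰j  | _        = ⊥-elim (0≰j (ℤ.+≤+ z≤n))
... | yes _   | no j≰i   = ⊥-elim (j≰i (ℤ.+≤+ j≤i))

bracket-< : ∀ {i j} → i ℤ.< j → bracket i j ≡ 0
bracket-< {i} {j} i<j with ℤ.+ 0 ℤ.≤? j | j ℤ.≤? i
... | yes _ | yes j≤i = ⊥-elim (ℤP.<⇒≱ i<j j≤i)
... | yes _ | no _    = refl
... | no _  | _       = refl

M-≥ : ∀ k m q → M (k + m) m q ≡ (k + q) C q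
M-≥ k m q = trans (cong (λ i → bracket i (ℤ.+ q)) top≡k+q) (bracket-≤ (m≤n+m q k))
  where
  open ≡-Reasoning
  top≡k+q : ℤ.+ (k + m + q) ℤ.- ℤ.+ m ≡ ℤ.+ (k + q)
  top≡k+q = begin
    ℤ.+ (k + m + q) ℤ.- ℤ.+ m   ≡⟨ ℤP.[+m]-[+n]≡m⊖n (k + m + q) m ⟩
    (k + m + q) ⊖ m             ≡⟨ cong (_⊖ m) (trans (cong (_+ q) (+-comm k m)) (+-assoc m k q)) ⟩
    (m + (k + q)) ⊖ m           ≡⟨ ℤP.⊖-≥ (m≤m+n m (k + q)) ⟩
    ℤ.+ (m + (k + q) ∸ m)       ≡⟨ cong ℤ.+_ (m+n∸m≡n m (k + q)) ⟩
    ℤ.+ (k + q)                 ∎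

M-< : ∀ {n m} q → n < m → M n m q ≡ 0
M-< {n} q n<m with m≤n⇒∃[o]m+o≡n n<m
... | o , refl = bracket-< top<q
  where
  open ℤP.≤-Reasoning
  top<q : ℤ.+ (n + q) ℤ.- ℤ.+ (suc n + o) ℤ.< ℤ.+ q
  top<q = begin-strict
    ℤ.+ (n + q) ℤ.- ℤ.+ (suc n + o)   ≡⟨ ℤP.[+m]-[+n]≡m⊖n (n + q) (suc n + o) ⟩
    (n + q) ⊖ (suc n + o)             ≡⟨ cong ((n + q) ⊖_) (sym (+-suc n o)) ⟩
    (n + q) ⊖ (n + suc o)             ≡⟨ ℤP.+-cancelˡ-⊖ n q (suc o) ⟩
    q ⊖ suc o                         <⟨ ℤP.m⊖1+n<m q (suc o) ⟩
    ℤ.+ q                             ∎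

-- (6) The permutations of split type σ = concatP ps.

module SplitTypeFibres {ps : List OneLine} (conn : All ConnectedPart ps) (nontriv : All Nontrivial ps) where

  size : ℕ
  size = length (concatP ps)

  -- the permutations of split type σ in S_(k + size)
  fibre : ℕ → List OneLine
  fibre k = map concatP (insertions k ps)

  insertion-connected : ∀ {k} r → Insertion k ps r → All ConnectedPart r
  insertion-connected r (refl , _) = All-insert trivial-connected r conn

  length-insertion : ∀ {k} r → Insertion k ps r → length (concatP r) ≡ k + size
  length-insertion r (refl , refl) = length-concatP r

  -- by uniqueness of split decompositions, the decomposition of a permutation
  -- of split type σ has ps as its nontrivial parts
  decomposition-insertion : ∀ {π} → IsSplitTypeOf π (concatP ps) →
                            ∃[ r ] (π ≡ concatP r × Insertion (copies r) ps r)
  decomposition-insertion (r , (conn-r , π≡r) , σ≡r) =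
    r , π≡r , concatP-injective (AllP.filter⁺ nontrivial? conn-r) conn (sym σ≡r) , refl

  fibre⇔ : ∀ k π → π ∈ fibre k ⇔ (InS (k + size) π × IsSplitTypeOf π (concatP ps))
  fibre⇔ k π = mk⇔ to from
    where
    to : π ∈ fibre k → InS (k + size) π × IsSplitTypeOf π (concatP ps)
    to π∈ with ∈-map⁻ concatP π∈
    ... | r , r∈ , refl =
      subst (λ n → InS n (concatP r)) (length-insertion r ins) (InS-concatP (insertion-connected r ins)) ,
      r , (insertion-connected r ins , refl) , cong concatP (sym (proj₁ ins))
      where
      ins : Insertion k ps r
      ins = insertions-sound k nontriv r∈
    from : InS (k + size) π × IsSplitTypeOf π (concatP ps) → π ∈ fibre k
    from (π∈S , split) with decomposition-insertion split
    ... | r , refl , ins = ∈-map⁺ concatP (insertion⇒∈ {r = r} (proj₁ ins , copies≡k))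
      where
      copies≡k : copies r ≡ k
      copies≡k = +-cancelʳ-≡ _ _ _ (trans (sym (length-insertion r ins)) (InS⇒length π∈S))

  size≤ : ∀ {n π} → InS n π × IsSplitTypeOf π (concatP ps) → size ≤ n
  size≤ (π∈S , split) with decomposition-insertion split
  ... | r , refl , ins = subst (size ≤_) (trans (sym (length-insertion r ins)) (InS⇒length π∈S)) (m≤n+m size _)

  fibre-unique : ∀ k → Unique (fibre k)
  fibre-unique k = unique-map-on concatP-injective
    (All.tabulate (λ {r} r∈ → insertion-connected r (insertions-sound k nontriv r∈))) (insertions-unique k nontriv)

  Enumeration : ℕ → ℕ → Set
  Enumeration n m = ∃[ L ] (Unique L × (∀ π → (π ∈ L ⇔ (InS n π × IsSplitTypeOf π (concatP ps))))
                            × length L ≡ M n m (length ps))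

  enumeration : ∀ n → Enumeration n size
  enumeration n with size ≤? n
  ... | yes size≤n = subst (λ n′ → Enumeration n′ size) (m∸n+n≡m size≤n) (enumeration-≥ (n ∸ size))
    where
    enumeration-≥ : ∀ k → Enumeration (k + size) size
    enumeration-≥ k = fibre k , fibre-unique k , fibre⇔ k ,
      trans (length-map concatP (insertions k ps))
            (trans (length-insertions k ps) (sym (M-≥ k size (length ps))))
  ... | no size≰n = [] , [] , (λ π → mk⇔ (λ ()) (λ π∈ → ⊥-elim (size≰n (size≤ π∈)))) ,
                    sym (M-< (length ps) (≰⇒> size≰n))

lemma2p4 : (m : ℕ) (σ : OneLine) → IsSplitType m σ →
    (ps : List OneLine) → SplitDecomp σ ps →
    (n : ℕ) → 1 ≤ n →
    ∃[ L ] (Unique L × (∀ π → (π ∈ L ⇔ (InS n π × IsSplitTypeOf π σ)))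
            × length L ≡ M n m (length ps))
lemma2p4 m σ (σ∈Sm , σ-split-type) ps (conn , refl) n _ =
  subst (Enumeration n) (InS⇒length σ∈Sm) (enumeration n)
  where
  open SplitTypeFibres conn (σ-split-type ps (conn , refl))
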